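{- Let $G$ be an interval graph and let $I,J$ be two independent sets of $G$ of the same size. Let $u$ be the leftmost vertex of $I$. For any token-sliding reconfiguration sequence from $I$ to $J$, the token on the leftmost vertex of $J$ is the token of origin $u$.
   Context: Each vertex $x$ of $G$ is represented by an interval with left extremity $l(x)$ and right extremity $r(x)$, all extremities pairwise distinct; vertices are adjacent iff their intervals intersect. The vertices of an independent set are totally ordered by their intervals (if $l(x)<l(y)$ then $r(x)<l(y)$); the leftmost vertex of an independent set is its smallest element in this order. A token-sliding reconfiguration sequence from $I$ to $J$ is a sequence of independent sets $I=I_0,I_1,\ldots,I_m=J$ such that for each $i$, $I_i\setminus I_{i+1}=\{x\}$, $I_{i+1}\setminus I_i=\{y\}$ and $xy$ is an edge (the move from $I_i$ to $I_{i+1}$ slides the token from $x$ to $y$). For $u\in I_0$, the token of origin $u$ is defined inductively: in $I_0$ it is $u$; if $t$ is the token of origin $u$ in $I_{i-1}$, then in $I_i$ it is $t$ if $t\in I_i$, and otherwise it is the vertex $y$ where $(t,y)$ is the move from $I_{i-1}$ to $I_i$. -}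

module Defs where

open import Data.Nat using (ℕ; _<_)
open import Data.Fin using (Fin)
open import Data.Fin.Subset using (Subset; _∈_; _∉_)
open import Data.Fin.Subset.Properties using (_∈?_)
open import Data.Product using (_×_)
open import Relation.Nullary using (¬_; yes; no)
open import Relation.Binary.PropositionalEquality using (_≡_; _≢_)
open import Function.Bundles using (_⇔_)

-- An interval model of a graph on vertex set Fin n: vertex x is the
-- interval [l x , r x], all 2n extremities pairwise distinct.
record IntervalModel (n : ℕ) : Set where
  field
    l r      : Fin n → ℕ
    l<r      : ∀ x → l x < r x
    l-inj    : ∀ x y → l x ≡ l y → x ≡ y
    r-inj    : ∀ x y → r x ≡ r y → x ≡ y
    l≢r      : ∀ x y → l x ≢ r y

module _ {n : ℕ} (G : IntervalModel n) where
  open IntervalModel G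

  Intersect : Fin n → Fin n → Set
  Intersect x y = (l x < r y) × (l y < r x)

  Adj : Fin n → Fin n → Set
  Adj x y = (x ≢ y) × Intersect x y

  Independent : Subset n → Set
  Independent S = ∀ x y → x ∈ S → y ∈ S → ¬ Adj x y

  Move : Subset n → Subset n → Fin n → Fin n → Set
  Move S T x y =
    (∀ z → ((z ∈ S) × (z ∉ T)) ⇔ (z ≡ x)) ×
    (∀ z → ((z ∈ T) × (z ∉ S)) ⇔ (z ≡ y)) ×
    Adj x y

  -- token-sliding reconfiguration sequence from S to J
  -- (every set after the first is required independent; the first
  --  one is assumed independent separately)
  data Reconf : Subset n → Subset n → Set where
    done : ∀ {S} → Reconf S S
    step : ∀ {S T J} (x y : Fin n) → Move S T x y → Independent T →
           Reconf T J → Reconf S J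

  -- position in the final set of the token whose position in the
  -- first set is t (defined as in the paper, step by step)
  token : ∀ {S J} → Reconf S J → Fin n → Fin n
  token done t = t
  token (step {T = T} x y _ _ rest) t with t ∈? T
  ... | yes _ = token rest t
  ... | no  _ = token rest y

  Leftmost : Fin n → Subset n → Set
  Leftmost v S = v ∈ S × (∀ w → w ∈ S → w ≢ v → l v < l w)

-- Induction along the sequence: the token of origin u always sits on the
-- leftmost vertex.  If that token stays on t and another one slides from x to a
-- new vertex y left of t, then l t < l x < r y, so y's interval meets t's.  If
-- it slides from t to y, any other token w left of y has l t < l w < l y < r t,
-- so w's interval meets t's.  The leftmost vertex of J being unique, the token
-- of origin u ends on it.
module Submission where

open import Defs
open import Data.Nat using (ℕ; _<_)
open import Data.Nat.Properties using (<-trans; <-asym; ≮⇒≥; ≤∧≢⇒<)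
open import Data.Fin using (Fin; _≟_)
open import Data.Fin.Subset using (Subset; ∣_∣; _∈_; _∉_)
open import Data.Fin.Subset.Properties using (_∈?_)
open import Data.Product using (_,_; proj₁; proj₂)
open import Relation.Nullary using (¬_; yes; no; contradiction)
open import Relation.Binary.PropositionalEquality using (_≡_; _≢_; refl; sym; subst; ≢-sym)
open import Function.Bundles using (Equivalence)

module _ {n : ℕ} (G : IntervalModel n) where
  open IntervalModel G

  starts-inside⇒Intersect : ∀ {p q} → l p < l q → l q < r p → Intersect G p q
  starts-inside⇒Intersect {q = q} lp<lq lq<rp = <-trans lp<lq (l<r q) , lq<rp

  Leftmost-intro : ∀ {v S} → v ∈ S →
                   (∀ w → w ∈ S → w ≢ v → ¬ l w < l v) → Leftmost G v S
  Leftmost-intro v∈S none-left =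
    v∈S , λ w w∈S w≢v →
      ≤∧≢⇒< (≮⇒≥ (none-left w w∈S w≢v)) (λ lv≡lw → w≢v (l-inj w _ (sym lv≡lw)))

  Leftmost-unique : ∀ {S a b} → Leftmost G a S → Leftmost G b S → a ≡ b
  Leftmost-unique {a = a} {b} (a∈S , a-left) (b∈S , b-left) with a ≟ b
  ... | yes a≡b = a≡b
  ... | no a≢b  = contradiction (b-left a a∈S a≢b) (<-asym (a-left b b∈S (≢-sym a≢b)))

  module MoveProperties {S T x y} (move : Move G S T x y) where
    private
      left  = proj₁ move
      enter = proj₁ (proj₂ move)

    source∈ : x ∈ S
    source∈ = proj₁ (Equivalence.from (left x) refl)

    source∉ : x ∉ T
    source∉ = proj₂ (Equivalence.from (left x) refl)

    target∈ : y ∈ T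
    target∈ = proj₁ (Equivalence.from (enter y) refl)

    left⇒source : ∀ {z} → z ∈ S → z ∉ T → z ≡ x
    left⇒source z∈S z∉T = Equivalence.to (left _) (z∈S , z∉T)

    entered⇒target : ∀ {z} → z ∈ T → z ∉ S → z ≡ y
    entered⇒target z∈T z∉S = Equivalence.to (enter _) (z∈T , z∉S)

    adjacent : Adj G x y
    adjacent = proj₂ (proj₂ move)

  Leftmost-stay : ∀ {S T x y t} → Move G S T x y → Independent G T → t ∈ T →
                  Leftmost G t S → Leftmost G t T
  Leftmost-stay {S} {T} {x} {t = t} move indT t∈T (t∈S , t-left) =
    Leftmost-intro t∈T none-left
    where
    open MoveProperties move

    lt<lx : l t < l x
    lt<lx = t-left x source∈ (λ x≡t → source∉ (subst (_∈ T) (sym x≡t) t∈T))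

    none-left : ∀ w → w ∈ T → w ≢ t → ¬ l w < l t
    none-left w w∈T w≢t lw<lt with w ∈? S
    ... | yes w∈S = <-asym lw<lt (t-left w w∈S w≢t)
    ... | no w∉S with entered⇒target w∈T w∉S
    ... | refl = indT w t w∈T t∈T
                   (w≢t , starts-inside⇒Intersect lw<lt (<-trans lt<lx (proj₁ (proj₂ adjacent))))

  Leftmost-slide : ∀ {S T x y t} → Move G S T x y → Independent G S → t ∉ T →
                   Leftmost G t S → Leftmost G y T
  Leftmost-slide {S} {T} {y = y} {t} move indS t∉T (t∈S , t-left)
    with MoveProperties.left⇒source move t∈S t∉T
  ... | refl = Leftmost-intro target∈ none-left
    where
    open MoveProperties move

    none-left : ∀ w → w ∈ T → w ≢ y → ¬ l w < l y
    none-left w w∈T w≢y lw<ly with w ∈? S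
    ... | no w∉S = w≢y (entered⇒target w∈T w∉S)
    ... | yes w∈S = indS t w t∈S w∈S
                      (t≢w , starts-inside⇒Intersect (t-left w w∈S (≢-sym t≢w))
                                                     (<-trans lw<ly (proj₂ (proj₂ adjacent))))
      where
      t≢w : t ≢ w
      t≢w t≡w = t∉T (subst (_∈ T) (sym t≡w) w∈T)

  token-Leftmost : ∀ {S J t} → Independent G S → (σ : Reconf G S J) →
                   Leftmost G t S → Leftmost G (token G σ t) J
  token-Leftmost indS done t-left = t-left
  token-Leftmost {t = t} indS (step {T = T} x y move indT σ) t-left with t ∈? T
  ... | yes t∈T = token-Leftmost indT σ (Leftmost-stay move indT t∈T t-left)
  ... | no t∉T  = token-Leftmost indT σ (Leftmost-slide move indS t∉T t-left)

lemma10 : {n : ℕ} (G : IntervalModel n) (I J : Subset n) →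
          Independent G I → Independent G J → ∣ I ∣ ≡ ∣ J ∣ →
          (u v : Fin n) → Leftmost G u I → Leftmost G v J →
          (σ : Reconf G I J) → token G σ u ≡ v
lemma10 G I J indI _ _ u v u-left v-left σ =
  Leftmost-unique G (token-Leftmost G indI σ u-left) v-left
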